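{- Let $d\ge2$ be an integer and suppose the edges of the complete graph $K_n$ are coloured so that for every $m$, every set of $m$ vertices spans at most $\frac d2 m\log m$ edges of any single colour. Then there is a vertex of $K_n$ incident with edges from $\Omega\!\left(\frac{n}{\log n}\right)$ distinct colour classes.
   Context: $X=\Omega(Y)$ means there is $c>0$ (possibly depending on $d$ but not on $n$ or the colouring) with $X\ge cY$ for all sufficiently large $n$. -}

module Defs where

open import Data.Nat using (ℕ; _^_; _*_; _≤_)
import Data.Nat as ℕ
open import Data.Fin using (Fin; _<?_; _≟_)
open import Data.Fin.Subset using (Subset; _∈_; ∣_∣)
open import Data.Fin.Subset.Properties using (_∈?_)
open import Data.List using (List; length; filter; map; concatMap; allFin; deduplicate)
open import Data.Product using (_×_; _,_)
open import Relation.Nullary using (¬?)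
open import Relation.Nullary.Decidable using (_×-dec_)
open import Relation.Binary.PropositionalEquality using (_≡_)

-- An edge colouring of K_n: colours are natural numbers; the colour of the
-- edge {i,j} (i ≠ j) is c i j, and colourings are required to be symmetric.
Colouring : ℕ → Set
Colouring n = Fin n → Fin n → ℕ

Symmetric : ∀ {n} → Colouring n → Set
Symmetric c = ∀ i j → c i j ≡ c j i

pairs : ∀ n → List (Fin n × Fin n)
pairs n = concatMap (λ i → map (i ,_) (allFin n)) (allFin n)

monoEdges : ∀ {n} → Colouring n → Subset n → ℕ → ℕ
monoEdges {n} c S k =
  length (filter (λ { (i , j) → (i <? j) ×-dec ((i ∈? S) ×-dec ((j ∈? S) ×-dec (c i j ℕ.≟ k))) })
                 (pairs n))

coloursAt : ∀ {n} → Colouring n → Fin n → ℕ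
coloursAt {n} c v =
  length (deduplicate ℕ._≟_ (map (c v) (filter (λ u → ¬? (u ≟ v)) (allFin n))))

-- "every set S of m vertices spans at most (d/2) m log₂ m edges of any one colour",
-- i.e. 2 * e ≤ d m log₂ m, written exactly (without reals) as 2^(2e) ≤ m^(d m).
Sparse : ∀ {n} → ℕ → Colouring n → Set
Sparse d c = ∀ (S : Subset _) (k : ℕ) → 2 ^ (2 * monoEdges c S k) ≤ ∣ S ∣ ^ (d * ∣ S ∣)

module Submission where

-- Let t be the largest number of colours at a vertex and, for each colour k, let V_k be the
-- set of vertices incident with an edge of colour k. Every edge of colour k lies inside V_k,
-- so by sparsity
--   n(n-1)/2 = Σ_k e_k(V_k) ≤ (d/2) Σ_k |V_k| log₂ |V_k| ≤ (d/2)(1 + log₂ n) Σ_k |V_k|,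
-- while double counting vertex-colour incidences gives Σ_k |V_k| = Σ_v (colours at v) ≤ n t.
-- Hence n - 1 ≤ d (1 + log₂ n) t, and so n ≤ 3 d t log₂ n once n ≥ 2.

open import Defs
open import Data.Bool.Base using (true)
open import Data.Fin using (Fin; _<?_)
import Data.Fin.Base as Fin
import Data.Fin.Properties as Fin
open import Data.Fin.Subset using (Subset; _∈_; ∣_∣)
open import Data.Fin.Subset.Properties using (∣p∣≤n) renaming (_∈?_ to _∈ₛ?_)
open import Data.List.Base
  using (List; []; _∷_; map; _++_; concat; concatMap; filter; length; allFin; deduplicate)
open import Data.List.Extrema.Nat using (argmax; f[xs]≤f[argmax])
open import Data.List.Membership.Propositional using () renaming (_∈_ to _∈ₗ_)
open import Data.List.Membership.Propositional.Properties
  using (∈-allFin; ∈-map⁺; ∈-filter⁺; ∈-deduplicate⁺; ∈-concat⁺′)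
open import Data.List.Properties using (map-++; map-∘; map-tabulate; length-tabulate)
open import Data.List.Relation.Unary.All as All using (All; []; _∷_)
open import Data.List.Relation.Unary.AllPairs using ([]; _∷_)
open import Data.List.Relation.Unary.Any using (here; there)
open import Data.List.Relation.Unary.Unique.Propositional using (Unique)
open import Data.List.Relation.Unary.Unique.Propositional.Properties using (allFin⁺)
open import Data.Nat using (ℕ; zero; suc; _+_; _*_; _^_; _≤_; _<_; z≤n; s≤s)
open import Data.Nat.ListAction using (sum)
open import Data.Nat.ListAction.Properties using (sum-++)
open import Data.Nat.Logarithm using (⌊log₂_⌋; ⌊log₂⌋-mono-≤; ⌊log₂[2^n]⌋≡n)
open import Data.Nat.Properties hiding (_<?_)
open import Data.Nat.Tactic.RingSolver using (solve-∀)
open import Algebra.Properties.CommutativeSemigroup +-commutativeSemigroup using (interchange)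
open import Data.List.Membership.DecPropositional _≟_ using () renaming (_∈?_ to _∈ₗ?_)
open import Data.List.Relation.Unary.Unique.DecPropositional.Properties _≟_ using (deduplicate-!)
open import Data.Product using (∃; ∃-syntax; _×_; _,_; map₂)
import Data.Vec.Base as Vec
open import Data.Vec.Properties using (lookup⇒[]=; lookup∘tabulate)
open import Function.Base using (_∘_)
open import Level using (0ℓ)
open import Relation.Binary.Definitions using (DecidableEquality; tri<; tri≈; tri>)
open import Relation.Binary.PropositionalEquality
open import Relation.Nullary using (Dec; yes; no; does; ¬_; ¬?; contradiction)
open import Relation.Nullary.Decidable using (_×-dec_)
open import Relation.Unary using (Pred; Decidable)

private variable
  A B : Set

∑ : List A → (A → ℕ) → ℕ
∑ xs f = sum (map f xs)

syntax ∑ xs (λ x → f) = ∑[ x ∈ xs ] f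

𝟙 : {P : Set} → Dec P → ℕ
𝟙 (yes _) = 1
𝟙 (no _)  = 0

𝟙-yes : {P : Set} (P? : Dec P) → P → 𝟙 P? ≡ 1
𝟙-yes (yes _) _ = refl
𝟙-yes (no ¬p) p = contradiction p ¬p

𝟙-no : {P : Set} (P? : Dec P) → ¬ P → 𝟙 P? ≡ 0
𝟙-no (yes p) ¬p = contradiction p ¬p
𝟙-no (no _)  _  = refl

∑-cong : ∀ (xs : List A) {f g : A → ℕ} → (∀ x → f x ≡ g x) → ∑ xs f ≡ ∑ xs g
∑-cong []       f≗g = refl
∑-cong (x ∷ xs) f≗g = cong₂ _+_ (f≗g x) (∑-cong xs f≗g)

∑-mono-≤ : ∀ (xs : List A) {f g : A → ℕ} → (∀ x → f x ≤ g x) → ∑ xs f ≤ ∑ xs g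
∑-mono-≤ []       f≤g = z≤n
∑-mono-≤ (x ∷ xs) f≤g = +-mono-≤ (f≤g x) (∑-mono-≤ xs f≤g)

∑-distrib-+ : ∀ (xs : List A) (f g : A → ℕ) → ∑[ x ∈ xs ] (f x + g x) ≡ ∑ xs f + ∑ xs g
∑-distrib-+ []       f g = refl
∑-distrib-+ (x ∷ xs) f g = begin
  f x + g x + ∑[ y ∈ xs ] (f y + g y)   ≡⟨ cong (f x + g x +_) (∑-distrib-+ xs f g) ⟩
  f x + g x + (∑ xs f + ∑ xs g)         ≡⟨ interchange (f x) (g x) (∑ xs f) (∑ xs g) ⟩
  f x + ∑ xs f + (g x + ∑ xs g)         ∎
  where open ≡-Reasoning

*-distribˡ-∑ : ∀ (xs : List A) a (f : A → ℕ) → a * ∑ xs f ≡ ∑[ x ∈ xs ] (a * f x)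
*-distribˡ-∑ []       a f = *-zeroʳ a
*-distribˡ-∑ (x ∷ xs) a f =
  trans (*-distribˡ-+ a (f x) (∑ xs f)) (cong (a * f x +_) (*-distribˡ-∑ xs a f))

∑-const : ∀ (xs : List A) b → ∑[ x ∈ xs ] b ≡ length xs * b
∑-const []       b = refl
∑-const (x ∷ xs) b = cong (b +_) (∑-const xs b)

∑-comm : ∀ (xs : List A) (ys : List B) (f : A → B → ℕ) →
         ∑[ x ∈ xs ] ∑[ y ∈ ys ] f x y ≡ ∑[ y ∈ ys ] ∑[ x ∈ xs ] f x y
∑-comm []       ys f = sym (trans (∑-const ys 0) (*-zeroʳ (length ys)))
∑-comm (x ∷ xs) ys f = begin
  ∑ ys (f x) + ∑[ x′ ∈ xs ] ∑[ y ∈ ys ] f x′ y   ≡⟨ cong (∑ ys (f x) +_) (∑-comm xs ys f) ⟩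
  ∑ ys (f x) + ∑[ y ∈ ys ] ∑[ x′ ∈ xs ] f x′ y   ≡⟨ ∑-distrib-+ ys (f x) (λ y → ∑[ x′ ∈ xs ] f x′ y) ⟨
  ∑[ y ∈ ys ] (f x y + ∑[ x′ ∈ xs ] f x′ y)      ∎
  where open ≡-Reasoning

∑-++ : ∀ (xs ys : List A) (f : A → ℕ) → ∑ (xs ++ ys) f ≡ ∑ xs f + ∑ ys f
∑-++ xs ys f = trans (cong sum (map-++ f xs ys)) (sum-++ (map f xs) (map f ys))

∑-map : ∀ (xs : List A) (h : A → B) (f : B → ℕ) → ∑ (map h xs) f ≡ ∑ xs (f ∘ h)
∑-map xs h f = cong sum (sym (map-∘ xs))

∑-concatMap : ∀ (xs : List A) (g : A → List B) (f : B → ℕ) →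
              ∑ (concatMap g xs) f ≡ ∑[ x ∈ xs ] ∑ (g x) f
∑-concatMap []       g f = refl
∑-concatMap (x ∷ xs) g f =
  trans (∑-++ (g x) (concatMap g xs) f) (cong (∑ (g x) f +_) (∑-concatMap xs g f))

∈⇒≤∑ : ∀ {xs : List A} {y} (f : A → ℕ) → y ∈ₗ xs → f y ≤ ∑ xs f
∈⇒≤∑             f (here refl) = m≤m+n _ _
∈⇒≤∑ {xs = x ∷ _} f (there y∈xs) = ≤-trans (∈⇒≤∑ f y∈xs) (m≤n+m _ (f x))

length-filter≡∑𝟙 : {P : Pred A 0ℓ} (P? : Decidable P) (xs : List A) →
                   length (filter P? xs) ≡ ∑[ x ∈ xs ] 𝟙 (P? x)
length-filter≡∑𝟙 P? []       = refl
length-filter≡∑𝟙 P? (x ∷ xs) with P? x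
... | yes _ = cong suc (length-filter≡∑𝟙 P? xs)
... | no  _ = length-filter≡∑𝟙 P? xs

∑-distrib-+₃ : ∀ (xs : List A) (f g h : A → ℕ) →
               ∑[ x ∈ xs ] (f x + g x + h x) ≡ ∑ xs f + ∑ xs g + ∑ xs h
∑-distrib-+₃ xs f g h = trans (∑-distrib-+ xs (λ x → f x + g x) h)
                              (cong (_+ ∑ xs h) (∑-distrib-+ xs f g))

∑-pairs : ∀ n (f : Fin n × Fin n → ℕ) →
          ∑ (pairs n) f ≡ ∑[ i ∈ allFin n ] ∑[ j ∈ allFin n ] f (i , j)
∑-pairs n f = trans (∑-concatMap (allFin n) (λ i → map (i ,_) (allFin n)) f)
                    (∑-cong (allFin n) (λ i → ∑-map (allFin n) (i ,_) f))

∑-allFin-const : ∀ n b → ∑[ i ∈ allFin n ] b ≡ n * b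
∑-allFin-const n b =
  trans (∑-const (allFin n) b) (cong (_* b) (length-tabulate {n = n} (λ i → i)))

∑-allFin-suc : ∀ n (f : Fin (suc n) → ℕ) →
               ∑ (allFin (suc n)) f ≡ f Fin.zero + ∑ (allFin n) (f ∘ Fin.suc)
∑-allFin-suc n f = cong (λ xs → f Fin.zero + sum xs)
  (trans (map-tabulate Fin.suc f) (sym (map-tabulate (λ i → i) (f ∘ Fin.suc))))

module _ (_≟_ : DecidableEquality A) where

  open import Data.List.Membership.DecPropositional _≟_ using (_∈?_)

  ∑𝟙≟≡0 : ∀ {xs : List A} {y} → All (λ x → ¬ y ≡ x) xs → ∑[ x ∈ xs ] 𝟙 (x ≟ y) ≡ 0
  ∑𝟙≟≡0 []                         = refl
  ∑𝟙≟≡0 {x ∷ _} {y} (y≢x ∷ y∉xs) =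
    cong₂ _+_ (𝟙-no (x ≟ y) (y≢x ∘ sym)) (∑𝟙≟≡0 y∉xs)

  Unique⇒∑𝟙≟≤1 : ∀ {xs : List A} → Unique xs → ∀ y → ∑[ x ∈ xs ] 𝟙 (x ≟ y) ≤ 1
  Unique⇒∑𝟙≟≤1 []                          y = z≤n
  Unique⇒∑𝟙≟≤1 {x ∷ _} (x∉xs ∷ !xs) y with x ≟ y
  ... | yes refl = ≤-reflexive (cong suc (∑𝟙≟≡0 x∉xs))
  ... | no  _    = Unique⇒∑𝟙≟≤1 !xs y

  Unique⇒∑𝟙∈≤length : ∀ {xs : List A} → Unique xs → ∀ ys → ∑[ x ∈ xs ] 𝟙 (x ∈? ys) ≤ length ys
  Unique⇒∑𝟙∈≤length {xs} !xs ys = begin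
    ∑[ x ∈ xs ] 𝟙 (x ∈? ys)                ≤⟨ ∑-mono-≤ xs 𝟙∈≤∑𝟙≟ ⟩
    ∑[ x ∈ xs ] ∑[ y ∈ ys ] 𝟙 (x ≟ y)      ≡⟨ ∑-comm xs ys (λ x y → 𝟙 (x ≟ y)) ⟩
    ∑[ y ∈ ys ] ∑[ x ∈ xs ] 𝟙 (x ≟ y)      ≤⟨ ∑-mono-≤ ys (Unique⇒∑𝟙≟≤1 !xs) ⟩
    ∑[ y ∈ ys ] 1                          ≡⟨ trans (∑-const ys 1) (*-identityʳ (length ys)) ⟩
    length ys                              ∎
    where
    open ≤-Reasoning
    𝟙∈≤∑𝟙≟ : ∀ x → 𝟙 (x ∈? ys) ≤ ∑[ y ∈ ys ] 𝟙 (x ≟ y)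
    𝟙∈≤∑𝟙≟ x with x ∈? ys
    ... | no  _    = z≤n
    ... | yes x∈ys = subst (_≤ ∑[ y ∈ ys ] 𝟙 (x ≟ y)) (𝟙-yes (x ≟ x) refl)
                           (∈⇒≤∑ (λ y → 𝟙 (x ≟ y)) x∈ys)

module _ {n : ℕ} {P : Pred (Fin n) 0ℓ} (P? : Decidable P) where

  subsetOf : Subset n
  subsetOf = Vec.tabulate (does ∘ P?)

  ∈-subsetOf : ∀ {u} → P u → u ∈ subsetOf
  ∈-subsetOf {u} Pu =
    lookup⇒[]= u subsetOf (trans (lookup∘tabulate (does ∘ P?) u) (does-yes (P? u)))
    where
    does-yes : (Pu? : Dec (P u)) → does Pu? ≡ true
    does-yes (yes _)  = refl
    does-yes (no ¬Pu) = contradiction Pu ¬Pu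

∣subsetOf∣≡∑𝟙 : ∀ {n} {P : Pred (Fin n) 0ℓ} (P? : Decidable P) →
                ∣ subsetOf P? ∣ ≡ ∑[ u ∈ allFin n ] 𝟙 (P? u)
∣subsetOf∣≡∑𝟙 {zero}  P? = refl
∣subsetOf∣≡∑𝟙 {suc n} P? rewrite ∑-allFin-suc n (𝟙 ∘ P?) with P? Fin.zero
... | yes _ = cong suc (∣subsetOf∣≡∑𝟙 (P? ∘ Fin.suc))
... | no  _ = ∣subsetOf∣≡∑𝟙 (P? ∘ Fin.suc)

-- Every ordered pair (i , j) has i < j, j < i or j ≡ i, and the first two kinds are equinumerous.
n*n≤2*∑𝟙<+n : ∀ n → n * n ≤ 2 * ∑[ i ∈ allFin n ] ∑[ j ∈ allFin n ] 𝟙 (i <? j) + n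
n*n≤2*∑𝟙<+n n = begin
  n * n                                      ≡⟨ ∑-allFin-const n n ⟨
  ∑[ i ∈ F ] n                               ≡⟨ ∑-cong F (λ _ → trans (∑-allFin-const n 1) (*-identityʳ n)) ⟨
  ∑[ i ∈ F ] ∑[ j ∈ F ] 1                    ≤⟨ ∑-mono-≤ F (λ i → ∑-mono-≤ F (trichotomy i)) ⟩
  ∑[ i ∈ F ] ∑[ j ∈ F ] (𝟙 (i <? j) + 𝟙 (j <? i) + 𝟙 (j Fin.≟ i))
    ≡⟨ ∑-cong F (λ i → ∑-distrib-+₃ F (λ j → 𝟙 (i <? j)) (λ j → 𝟙 (j <? i)) (λ j → 𝟙 (j Fin.≟ i))) ⟩
  ∑[ i ∈ F ] (∑[ j ∈ F ] 𝟙 (i <? j) + ∑[ j ∈ F ] 𝟙 (j <? i) + ∑[ j ∈ F ] 𝟙 (j Fin.≟ i))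
    ≡⟨ ∑-distrib-+₃ F _ _ _ ⟩
  ascending + ∑[ i ∈ F ] ∑[ j ∈ F ] 𝟙 (j <? i) + ∑[ i ∈ F ] ∑[ j ∈ F ] 𝟙 (j Fin.≟ i)
    ≤⟨ +-mono-≤ (≤-reflexive (cong (ascending +_) (∑-comm F F (λ i j → 𝟙 (j <? i))))) diagonal ⟩
  ascending + ascending + n * 1
    ≡⟨ cong₂ _+_ (cong (ascending +_) (sym (+-identityʳ ascending))) (*-identityʳ n) ⟩
  2 * ascending + n                          ∎
  where
  open ≤-Reasoning
  F = allFin n
  ascending = ∑[ i ∈ F ] ∑[ j ∈ F ] 𝟙 (i <? j)
  trichotomy : ∀ i j → 1 ≤ 𝟙 (i <? j) + 𝟙 (j <? i) + 𝟙 (j Fin.≟ i)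
  trichotomy i j with Fin.<-cmp i j
  ... | tri< i<j _ _ = ≤-trans (≤-reflexive (sym (𝟙-yes (i <? j) i<j))) (≤-trans (m≤m+n _ _) (m≤m+n _ _))
  ... | tri> _ _ j<i = ≤-trans (≤-reflexive (sym (𝟙-yes (j <? i) j<i))) (≤-trans (m≤n+m _ (𝟙 (i <? j))) (m≤m+n _ _))
  ... | tri≈ _ i≡j _ = ≤-trans (≤-reflexive (sym (𝟙-yes (j Fin.≟ i) (sym i≡j)))) (m≤n+m _ _)
  diagonal : ∑[ i ∈ F ] ∑[ j ∈ F ] 𝟙 (j Fin.≟ i) ≤ n * 1
  diagonal = subst (∑[ i ∈ F ] ∑[ j ∈ F ] 𝟙 (j Fin.≟ i) ≤_) (∑-allFin-const n 1)
                   (∑-mono-≤ F (Unique⇒∑𝟙≟≤1 Fin._≟_ (allFin⁺ n)))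

2^-cancel-≤ : ∀ {a b} → 2 ^ a ≤ 2 ^ b → a ≤ b
2^-cancel-≤ {a} {b} 2^a≤2^b =
  subst₂ _≤_ (⌊log₂[2^n]⌋≡n a) (⌊log₂[2^n]⌋≡n b) (⌊log₂⌋-mono-≤ 2^a≤2^b)

n<2^suc⌊log₂n⌋ : ∀ n → n < 2 ^ suc ⌊log₂ n ⌋
n<2^suc⌊log₂n⌋ n = ≰⇒> λ 2^[1+L]≤n →
  <-irrefl refl (subst (_≤ ⌊log₂ n ⌋) (⌊log₂[2^n]⌋≡n (suc ⌊log₂ n ⌋)) (⌊log₂⌋-mono-≤ 2^[1+L]≤n))

n*n≤[1+L]*d*[n*t]+n⇒n≤3*d*t*L : ∀ {n d t L} → 2 ≤ n → 1 ≤ d → 1 ≤ L →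
                                n * n ≤ suc L * (d * (n * t)) + n → n ≤ 3 * d * t * L
n*n≤[1+L]*d*[n*t]+n⇒n≤3*d*t*L {n@(suc _)} {d} {t} {L} 2≤n 1≤d 1≤L n²≤ = bound t n≤
  where
  factor : ∀ n L d t → suc L * (d * (n * t)) + n ≡ n * (suc L * d * t + 1)
  factor = solve-∀
  split : ∀ L d t → suc L * d * t + 1 ≡ d * t + L * d * t + 1
  split = solve-∀
  triple : ∀ L d t → L * d * t + L * d * t + L * d * t ≡ 3 * d * t * L
  triple = solve-∀

  n≤ : n ≤ suc L * d * t + 1
  n≤ = *-cancelˡ-≤ n (subst (n * n ≤_) (factor n L d t) n²≤)

  bound : ∀ t → n ≤ suc L * d * t + 1 → n ≤ 3 * d * t * L
  bound zero      n≤1 = contradiction (≤-trans 2≤n n≤0+1) λ { (s≤s ()) }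
    where
    n≤0+1 : n ≤ 0 + 1
    n≤0+1 = subst (n ≤_) (cong (_+ 1) (*-zeroʳ (suc L * d))) n≤1
  bound t@(suc _) n≤′ = begin
    n                                    ≤⟨ n≤′ ⟩
    suc L * d * t + 1                    ≡⟨ split L d t ⟩
    d * t + L * d * t + 1                ≤⟨ +-mono-≤ (+-monoˡ-≤ (L * d * t) dt≤Ldt) 1≤Ldt ⟩
    L * d * t + L * d * t + L * d * t    ≡⟨ triple L d t ⟩
    3 * d * t * L                        ∎
    where
    open ≤-Reasoning
    dt≤Ldt : d * t ≤ L * d * t
    dt≤Ldt = subst₂ _≤_ (*-identityˡ (d * t)) (sym (*-assoc L d t)) (*-monoˡ-≤ (d * t) 1≤L)
    1≤Ldt : 1 ≤ L * d * t
    1≤Ldt = *-mono-≤ (*-mono-≤ 1≤L 1≤d) (s≤s z≤n)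

module _ {n : ℕ} (c : Colouring n) where

  colours : Fin n → List ℕ
  colours v = deduplicate _≟_ (map (c v) (filter (λ u → ¬? (u Fin.≟ v)) (allFin n)))

  palette : List ℕ
  palette = deduplicate _≟_ (concat (map colours (allFin n)))

  colourClass : ℕ → Subset n
  colourClass k = subsetOf (λ u → k ∈ₗ? colours u)

  colour∈colours : ∀ i j → ¬ j ≡ i → c i j ∈ₗ colours i
  colour∈colours i j j≢i =
    ∈-deduplicate⁺ _≟_ (∈-map⁺ (c i) (∈-filter⁺ (λ u → ¬? (u Fin.≟ i)) (∈-allFin j) j≢i))

  colour∈palette : ∀ i j → ¬ j ≡ i → c i j ∈ₗ palette
  colour∈palette i j j≢i =
    ∈-deduplicate⁺ _≟_ (∈-concat⁺′ (colour∈colours i j j≢i) (∈-map⁺ colours (∈-allFin i)))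

  MonoEdge : Subset n → ℕ → Fin n → Fin n → Set
  MonoEdge S k i j = i Fin.< j × i ∈ S × j ∈ S × c i j ≡ k

  monoEdge? : ∀ S k i j → Dec (MonoEdge S k i j)
  monoEdge? S k i j = (i <? j) ×-dec ((i ∈ₛ? S) ×-dec ((j ∈ₛ? S) ×-dec (c i j ≟ k)))

  monoEdges≡∑𝟙 : ∀ S k → monoEdges c S k ≡ ∑[ i ∈ allFin n ] ∑[ j ∈ allFin n ] 𝟙 (monoEdge? S k i j)
  monoEdges≡∑𝟙 S k = trans (length-filter≡∑𝟙 _ (pairs n)) (∑-pairs n _)

  ∑𝟙<≤∑monoEdges : Symmetric c →
    ∑[ i ∈ allFin n ] ∑[ j ∈ allFin n ] 𝟙 (i <? j) ≤ ∑[ k ∈ palette ] monoEdges c (colourClass k) k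
  ∑𝟙<≤∑monoEdges symm = begin
    ∑[ i ∈ F ] ∑[ j ∈ F ] 𝟙 (i <? j)                     ≤⟨ ∑-mono-≤ F (λ i → ∑-mono-≤ F (λ j → edgeCovered i j (i <? j))) ⟩
    ∑[ i ∈ F ] ∑[ j ∈ F ] ∑[ k ∈ palette ] mono k i j    ≡⟨ ∑-cong F (λ i → ∑-comm F palette (λ j k → mono k i j)) ⟩
    ∑[ i ∈ F ] ∑[ k ∈ palette ] ∑[ j ∈ F ] mono k i j    ≡⟨ ∑-comm F palette (λ i k → ∑[ j ∈ F ] mono k i j) ⟩
    ∑[ k ∈ palette ] ∑[ i ∈ F ] ∑[ j ∈ F ] mono k i j    ≡⟨ ∑-cong palette (λ k → monoEdges≡∑𝟙 (colourClass k) k) ⟨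
    ∑[ k ∈ palette ] monoEdges c (colourClass k) k       ∎
    where
    open ≤-Reasoning
    F = allFin n
    mono : ℕ → Fin n → Fin n → ℕ
    mono k i j = 𝟙 (monoEdge? (colourClass k) k i j)
    edgeCovered : ∀ i j (i<?j : Dec (i Fin.< j)) → 𝟙 i<?j ≤ ∑[ k ∈ palette ] mono k i j
    edgeCovered i j (no  _)   = z≤n
    edgeCovered i j (yes i<j) = subst (_≤ ∑[ k ∈ palette ] mono k i j)
        (𝟙-yes (monoEdge? (colourClass k) k i j) (i<j , i∈class , j∈class , refl))
        (∈⇒≤∑ (λ k → mono k i j) (colour∈palette i j j≢i))
      where
      k = c i j
      j≢i : ¬ j ≡ i
      j≢i refl = Fin.<-irrefl refl i<j
      i∈class : i ∈ colourClass k
      i∈class = ∈-subsetOf (λ u → k ∈ₗ? colours u) (colour∈colours i j j≢i)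
      j∈class : j ∈ colourClass k
      j∈class = ∈-subsetOf (λ u → k ∈ₗ? colours u)
                  (subst (_∈ₗ colours j) (symm j i) (colour∈colours j i (j≢i ∘ sym)))

  2*monoEdges≤ : ∀ d → Sparse d c → ∀ S k → 2 * monoEdges c S k ≤ suc ⌊log₂ n ⌋ * (d * ∣ S ∣)
  2*monoEdges≤ d sparse S k = 2^-cancel-≤ (begin
    2 ^ (2 * monoEdges c S k)                 ≤⟨ sparse S k ⟩
    ∣ S ∣ ^ (d * ∣ S ∣)                        ≤⟨ ^-monoˡ-≤ (d * ∣ S ∣) ∣S∣≤2^[1+L] ⟩
    (2 ^ suc ⌊log₂ n ⌋) ^ (d * ∣ S ∣)          ≡⟨ ^-*-assoc 2 (suc ⌊log₂ n ⌋) (d * ∣ S ∣) ⟩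
    2 ^ (suc ⌊log₂ n ⌋ * (d * ∣ S ∣))          ∎)
    where
    open ≤-Reasoning
    ∣S∣≤2^[1+L] : ∣ S ∣ ≤ 2 ^ suc ⌊log₂ n ⌋
    ∣S∣≤2^[1+L] = ≤-trans (∣p∣≤n S) (<⇒≤ (n<2^suc⌊log₂n⌋ n))

  ∑∣colourClass∣≤n*t : ∀ t → (∀ u → coloursAt c u ≤ t) → ∑[ k ∈ palette ] ∣ colourClass k ∣ ≤ n * t
  ∑∣colourClass∣≤n*t t coloursAt≤t = begin
    ∑[ k ∈ palette ] ∣ colourClass k ∣               ≡⟨ ∑-cong palette (λ k → ∣subsetOf∣≡∑𝟙 (λ u → k ∈ₗ? colours u)) ⟩
    ∑[ k ∈ palette ] ∑[ u ∈ F ] 𝟙 (k ∈ₗ? colours u)   ≡⟨ ∑-comm palette F (λ k u → 𝟙 (k ∈ₗ? colours u)) ⟩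
    ∑[ u ∈ F ] ∑[ k ∈ palette ] 𝟙 (k ∈ₗ? colours u)   ≤⟨ ∑-mono-≤ F (λ u → ≤-trans (palette≤ u) (coloursAt≤t u)) ⟩
    ∑[ u ∈ F ] t                                      ≡⟨ ∑-allFin-const n t ⟩
    n * t                                             ∎
    where
    open ≤-Reasoning
    F = allFin n
    palette≤ : ∀ u → ∑[ k ∈ palette ] 𝟙 (k ∈ₗ? colours u) ≤ coloursAt c u
    palette≤ u =
      Unique⇒∑𝟙∈≤length _≟_ (deduplicate-! (concat (map colours (allFin n)))) (colours u)

  n*n≤[1+log₂n]*d*[n*t]+n : ∀ d → Symmetric c → Sparse d c → ∀ t → (∀ u → coloursAt c u ≤ t) →
                            n * n ≤ suc ⌊log₂ n ⌋ * (d * (n * t)) + n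
  n*n≤[1+log₂n]*d*[n*t]+n d symm sparse t coloursAt≤t = begin
    n * n                                                   ≤⟨ n*n≤2*∑𝟙<+n n ⟩
    2 * ∑[ i ∈ F ] ∑[ j ∈ F ] 𝟙 (i <? j) + n                ≤⟨ +-monoˡ-≤ n (*-monoʳ-≤ 2 (∑𝟙<≤∑monoEdges symm)) ⟩
    2 * ∑[ k ∈ palette ] e k + n                            ≡⟨ cong (_+ n) (*-distribˡ-∑ palette 2 e) ⟩
    ∑[ k ∈ palette ] (2 * e k) + n                            ≤⟨ +-monoˡ-≤ n (∑-mono-≤ palette (λ k → 2*monoEdges≤ d sparse (colourClass k) k)) ⟩
    ∑[ k ∈ palette ] (L′ * (d * ∣ colourClass k ∣)) + n       ≡⟨ cong (_+ n) pull-out ⟨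
    L′ * (d * ∑[ k ∈ palette ] ∣ colourClass k ∣) + n       ≤⟨ +-monoˡ-≤ n (*-monoʳ-≤ L′ (*-monoʳ-≤ d (∑∣colourClass∣≤n*t t coloursAt≤t))) ⟩
    L′ * (d * (n * t)) + n                                  ∎
    where
    open ≤-Reasoning
    F = allFin n
    L′ = suc ⌊log₂ n ⌋
    e : ℕ → ℕ
    e k = monoEdges c (colourClass k) k
    pull-out : L′ * (d * ∑[ k ∈ palette ] ∣ colourClass k ∣)
               ≡ ∑[ k ∈ palette ] (L′ * (d * ∣ colourClass k ∣))
    pull-out = trans (cong (L′ *_) (*-distribˡ-∑ palette d (λ k → ∣ colourClass k ∣)))
                     (*-distribˡ-∑ palette L′ (λ k → d * ∣ colourClass k ∣))

maximum-Fin : ∀ {m} (f : Fin (suc m) → ℕ) → ∃[ v ] (∀ u → f u ≤ f v)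
maximum-Fin {m} f = argmax f Fin.zero (allFin (suc m)) ,
  λ u → All.lookup (f[xs]≤f[argmax] {f = f} Fin.zero (allFin (suc m))) (∈-allFin u)

proposition4p4 : ∀ (d : ℕ) → 2 ≤ d →
    ∃[ C ] ∃[ N ] ∀ (n : ℕ) → N ≤ n → (c : Colouring n) → Symmetric c → Sparse d c →
      ∃[ v ] n ≤ C * coloursAt c v * ⌊log₂ n ⌋
proposition4p4 d 2≤d = 3 * d , 2 , λ where
    (suc _) 2≤n c symm sparse → map₂ (λ {v} → atMaximum 2≤n c symm sparse {v}) (maximum-Fin (coloursAt c))
  where
  atMaximum : ∀ {n} → 2 ≤ n → (c : Colouring n) → Symmetric c → Sparse d c → ∀ {v} →
              (∀ u → coloursAt c u ≤ coloursAt c v) → n ≤ 3 * d * coloursAt c v * ⌊log₂ n ⌋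
  atMaximum 2≤n c symm sparse {v} maximal =
    n*n≤[1+L]*d*[n*t]+n⇒n≤3*d*t*L 2≤n (≤-trans (s≤s z≤n) 2≤d) (⌊log₂⌋-mono-≤ 2≤n)
      (n*n≤[1+log₂n]*d*[n*t]+n c d symm sparse (coloursAt c v) maximal)
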